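{- (Soundness.) If a sequent $\Gamma\Rightarrow\Delta$ of compound diagrams is provable in the calculus $\mathsf{LJ}_{EV}$, then $\Gamma\Rightarrow\Delta$ is valid.
   Context: Setting. Fix a countable set $\mathcal V$ of propositional variables (contours). A Heyting algebra $(H,\vee,\wedge,\to,0,1)$ is a bounded distributive lattice with relative pseudo-complement $\to$ ($c\wedge a\le b$ iff $c\le a\to b$); $-a:=a\to0$; empty meets $=1$, empty joins $=0$. A valuation is a map $v:\mathcal V\to H$. Diagrams. A zone for finite $L\subset\mathcal V$ is a pair $z=(z^{in},z^{out})$ of disjoint subsets of $L$ with union $L$; $\mathcal Z(L)$ = all zones for $L$. $v(z)=\bigwedge_{c\in z^{in}}v(c)\wedge\bigwedge_{c\in z^{out}}-v(c)$, $m_v(z)=\bigwedge_{c\in z^{in}}v(c)\to\bigvee_{c\in z^{out}}v(c)$. Unitary diagrams are of three kinds: a Venn diagram $(L,\mathcal Z(L),S)$, $S\subseteq\mathcal Z(L)$ shaded, with $v=\bigvee_{z\in S}v(z)$; a pure Euler diagram $d=(L,Z)$, $Z\subseteq\mathcal Z(L)$, missing zones $M(d)=\mathcal Z(L)\setminus Z$, $v(d)=\bigwedge_{z\in M(d)}m_v(z)$; an Euler–Venn diagram $d=(L,Z,S)$, $S\subseteq Z$, with $\mathrm{venn}(d)=(L,\mathcal Z(L),S)$, $\mathrm{euler}(d)=(L,Z)$, $v(d)=v(\mathrm{euler}(d))\to v(\mathrm{venn}(d))$. Special Venn diagrams: $\bot=(\emptyset,\{(\emptyset,\emptyset)\},\emptyset)$,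 $\top=(\emptyset,\{(\emptyset,\emptyset)\},\{(\emptyset,\emptyset)\})$, positive literal $p_c=(\{c\},\mathcal Z(\{c\}),\{(\{c\},\emptyset)\})$, negative literal $n_c=(\{c\},\mathcal Z(\{c\}),\{(\emptyset,\{c\})\})$. For $c\in L$: $\mathrm{adj}(z,c)$ is $z$ with $c$ moved to the other side; $z\setminus c=(z^{in}\setminus\{c\},z^{out}\setminus\{c\})$; $(L,Z)\setminus c=(L\setminus\{c\},\{z\setminus c\mid z\in Z\})$. Compound diagrams: $D::=d\mid D\wedge D\mid D\vee D\mid D\to D$ ($d$ unitary) with Heyting operations as semantics. Sequents. $\Gamma\Rightarrow\Delta$ with $\Gamma,\Delta$ finite multisets of compound diagrams; valid iff $\bigwedge_{\Gamma}v\le\bigvee_{\Delta}v$ for all valuations in all Heyting algebras. The calculus $\mathsf{LJ}_{EV}$. A proof is a finite tree of sequents built by the rules below whose leaves are axioms $p_c,\Gamma\Rightarrow\Delta,p_c$ or instances of the zero-premiss rules ($\bot$L) $\bot,\Gamma\Rightarrow\Delta$ and ($\top$R) $\Gamma\Rightarrow\Delta,\top$. ($\Gamma,\Delta$ arbitrary throughout; "from $P$ infer $C$".) Sentential: (∧L) $D,E,\Gamma\Rightarrow\Delta$ / $D\wedge E,\Gamma\Rightarrow\Delta$; (∨L) $D,\Gamma\Rightarrow\Delta$ and $E,\Gamma\Rightarrow\Delta$ / $D\vee E,\Gamma\Rightarrow\Delta$; (→L) $\Gamma,D\to E\Rightarrow D$ and $E,\Gamma\Rightarrow\Delta$ / $D\to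 E,\Gamma\Rightarrow\Delta$; (∧R) $\Gamma\Rightarrow\Delta,D$ and $\Gamma\Rightarrow\Delta,E$ / $\Gamma\Rightarrow\Delta,D\wedge E$; (∨R) $\Gamma\Rightarrow\Delta,D,E$ / $\Gamma\Rightarrow\Delta,D\vee E$; (→R) $D,\Gamma\Rightarrow E$ / $\Gamma\Rightarrow\Delta,D\to E$. Venn: (LitL) $n_c,\Gamma\Rightarrow p_c$ / $n_c,\Gamma\Rightarrow\Delta$; (LitR) $p_c,\Gamma\Rightarrow$ / $\Gamma\Rightarrow\Delta,n_c$; for a Venn diagram $d=(L,\mathcal Z(L),S)$, $|S|>1$, $d_i=(L,\mathcal Z(L),S_i)$, $S=S_1\cup S_2$: (SepL) $d_1,\Gamma\Rightarrow\Delta$ and $d_2,\Gamma\Rightarrow\Delta$ / $d,\Gamma\Rightarrow\Delta$; (SepR) $\Gamma\Rightarrow\Delta,d_1,d_2$ / $\Gamma\Rightarrow\Delta,d$; for a Venn diagram $d$ with only shaded zone $(\{n_1..n_k\},\{o_1..o_l\})$: (DecL) $p_{n_1},..,p_{n_k},n_{o_1},..,n_{o_l},\Gamma\Rightarrow\Delta$ / $d,\Gamma\Rightarrow\Delta$; (DecR) all $\Gamma\Rightarrow\Delta,p_{n_i}$ and all $\Gamma\Rightarrow\Delta,n_{o_j}$ / $\Gamma\Rightarrow\Delta,d$. Pure Euler: for $d=(L,Z)$ such that every $z\in M(d)$ has some $\ell\in L$ with $\mathrm{adj}(z,\ell)\in M(d)$, and $\{c_1..c_k\}\subseteq L$ the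 maximal set with $M(d\setminus c_i)\ne\emptyset$: (RedL) $d\setminus c_1,..,d\setminus c_k,\Gamma\Rightarrow\Delta$ / $d,\Gamma\Rightarrow\Delta$; (RedR) all $\Gamma\Rightarrow\Delta,d\setminus c_i$ / $\Gamma\Rightarrow\Delta,d$. For $d=(L,Z)$ with $|M(d)|>1$ and $d_1=(L,Z_1),d_2=(L,Z_2)$ with $Z_1\cap Z_2=Z$: (MSepL) $d_1,d_2,\Gamma\Rightarrow\Delta$ / $d,\Gamma\Rightarrow\Delta$; (MSepR) $\Gamma\Rightarrow\Delta,d_1$ and $\Gamma\Rightarrow\Delta,d_2$ / $\Gamma\Rightarrow\Delta,d$. For $d$ with single missing zone $(\{n_1..n_k\},\{o_1..o_l\})$: (ImpDecL) all $d,\Gamma\Rightarrow p_{n_i}$ and all $p_{o_j},\Gamma\Rightarrow\Delta$ / $d,\Gamma\Rightarrow\Delta$; (ImpDecR) $\Gamma,p_{n_1},..,p_{n_k}\Rightarrow p_{o_1},..,p_{o_l}$ / $\Gamma\Rightarrow\Delta,d$. Euler–Venn: for an Euler–Venn diagram $d$: (DetL) $d,\Gamma\Rightarrow\mathrm{euler}(d)$ and $\mathrm{venn}(d),\Gamma\Rightarrow\Delta$ / $d,\Gamma\Rightarrow\Delta$; (DetR) $\mathrm{euler}(d),\Gamma\Rightarrow\mathrm{venn}(d)$ / $\Gamma\Rightarrow\Delta,d$. -}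

module Defs where

open import Level using (Level; Setω)
open import Data.Nat using (ℕ; zero; suc; _<_)
open import Data.Bool using (Bool; true; false; not; if_then_else_)
open import Data.Fin using (Fin)
open import Data.Vec as Vec using (Vec; []; _∷_; removeAt; updateAt)
open import Data.Vec.Relation.Unary.All as VAll using ([]; _∷_)
open import Data.Vec.Relation.Unary.AllPairs using ([]; _∷_)
open import Data.Vec.Relation.Unary.Unique.Propositional using (Unique)
open import Data.List as List using (List; []; _∷_; _++_; map; filter; concatMap; length)
open import Data.List.Membership.Propositional using (_∈_)
open import Data.List.Membership.DecPropositional as DecMem using ()
open import Data.List.Relation.Binary.Subset.Propositional using (_⊆_)
open import Data.List.Relation.Binary.Permutation.Propositional using (_↭_)
open import Data.List.Relation.Unary.Any using (Any)
open import Data.Product using (Σ; ∃; ∃-syntax; _×_; _,_)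
open import Data.Sum using (_⊎_)
open import Function.Bundles using (_⇔_)
open import Relation.Nullary using (¬_; ¬?)
open import Relation.Binary.PropositionalEquality using (_≡_; _≢_; refl)
open import Relation.Binary.Lattice.Bundles using (HeytingAlgebra)
import Data.Vec.Properties as VecP
import Data.Bool.Properties as BoolP

-- Contours (propositional variables): the countable set ℕ.

Var : Set
Var = ℕ

-- A diagram's contour set L is a duplicate-free vector  L : Vec Var n
-- (a finite set, listed in some order).  A zone (z^in , z^out) for L is
-- represented by its characteristic bit-vector: position i is  true  iff
-- the i-th contour of L lies in z^in (otherwise it lies in z^out).
-- Thus every  z : Zone n  is a zone for L and every zone for L arises
-- this way, exactly once.

Zone : ℕ → Set
Zone n = Vec Bool n

allZones : (n : ℕ) → List (Zone n)
allZones zero    = [] ∷ []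
allZones (suc n) = concatMap (λ z → (true ∷ z) ∷ (false ∷ z) ∷ []) (allZones n)

_≟z_ : ∀ {n} → (z z' : Zone n) → Relation.Nullary.Dec (z ≡ z')
_≟z_ = VecP.≡-dec BoolP._≟_

_∈z?_ : ∀ {n} (z : Zone n) (Z : List (Zone n)) → Relation.Nullary.Dec (z ∈ Z)
_∈z?_ = DecMem._∈?_ _≟z_

inside : ∀ {n} → Vec Var n → Zone n → List Var
inside []       []          = []
inside (c ∷ L)  (true  ∷ z) = c ∷ inside L z
inside (c ∷ L)  (false ∷ z) = inside L z

outside : ∀ {n} → Vec Var n → Zone n → List Var
outside []       []          = []
outside (c ∷ L)  (true  ∷ z) = outside L z
outside (c ∷ L)  (false ∷ z) = c ∷ outside L z

adj : ∀ {n} → Zone n → Fin n → Zone n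
adj z ℓ = updateAt z ℓ not

private
  all-removeAt : ∀ {a p} {A : Set a} {P : A → Set p} {n}
                 (xs : Vec A (suc n)) (i : Fin (suc n)) →
                 VAll.All P xs → VAll.All P (removeAt xs i)
  all-removeAt (x ∷ xs)     Fin.zero    (px ∷ pxs) = pxs
  all-removeAt (x ∷ y ∷ xs) (Fin.suc i) (px ∷ pxs) = px ∷ all-removeAt (y ∷ xs) i pxs

  unique-removeAt : ∀ {n} (xs : Vec Var (suc n)) (i : Fin (suc n)) →
                    Unique xs → Unique (removeAt xs i)
  unique-removeAt (x ∷ xs)     Fin.zero    (_ ∷ u)  = u
  unique-removeAt (x ∷ y ∷ xs) (Fin.suc i) (px ∷ u) =
    all-removeAt (y ∷ xs) i px ∷ unique-removeAt (y ∷ xs) i u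

  unique-one : (c : Var) → Unique (c ∷ [])
  unique-one c = [] ∷ []

-- The well-formedness proofs are irrelevant fields,
-- so diagrams with the same data are definitionally equal.
--   venn  n L u S     : Venn diagram (L, Z(L), S), S shaded
--   euler n L u Z     : pure Euler diagram (L, Z)
--   ev    n L u Z S s : Euler-Venn diagram (L, Z, S), S ⊆ Z
-- Sets of zones are lists (order and repetition irrelevant).

data Unitary : Set where
  venn  : (n : ℕ) (L : Vec Var n) .(u : Unique L) (S : List (Zone n)) → Unitary
  euler : (n : ℕ) (L : Vec Var n) .(u : Unique L) (Z : List (Zone n)) → Unitary
  ev    : (n : ℕ) (L : Vec Var n) .(u : Unique L) (Z S : List (Zone n))
          .(s : S ⊆ Z) → Unitary

data Diagram : Set where
  unit : Unitary → Diagram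
  _∧ᵈ_ _∨ᵈ_ _⇒ᵈ_ : Diagram → Diagram → Diagram

⊥ᵈ ⊤ᵈ : Diagram
⊥ᵈ = unit (venn 0 [] [] [])
⊤ᵈ = unit (venn 0 [] [] ([] ∷ []))

pos neg : Var → Diagram
pos c = unit (venn 1 (c ∷ []) (unique-one c) ((true ∷ []) ∷ []))
neg c = unit (venn 1 (c ∷ []) (unique-one c) ((false ∷ []) ∷ []))

missing : ∀ {n} → List (Zone n) → List (Zone n)
missing {n} Z = filter (λ z → ¬? (z ∈z? Z)) (allZones n)

removeZones : ∀ {n} → List (Zone (suc n)) → Fin (suc n) → List (Zone n)
removeZones Z i = map (λ z → removeAt z i) Z

eulerRemove : ∀ {n} (L : Vec Var (suc n)) .(u : Unique L)
              (Z : List (Zone (suc n))) (i : Fin (suc n)) → Diagram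
eulerRemove L u Z i =
  unit (euler _ (removeAt L i) (unique-removeAt L i u) (removeZones Z i))

reductions : ∀ {n} (L : Vec Var n) .(u : Unique L) (Z : List (Zone n)) → List Diagram
reductions {zero}  L u Z = []
reductions {suc n} L u Z =
  map (eulerRemove L u Z)
      (filter (λ i → ¬? (Data.List.Properties.≡-dec _≟z_ (missing (removeZones Z i)) []))
              (List.allFin (suc n)))
  where import Data.List.Properties

MoreThanOne : ∀ {n} → List (Zone n) → Set
MoreThanOne S = ∃[ z₁ ] ∃[ z₂ ] (z₁ ∈ S × z₂ ∈ S × z₁ ≢ z₂)

IsUnion : ∀ {n} → List (Zone n) → List (Zone n) → List (Zone n) → Set
IsUnion S S₁ S₂ = ∀ z → z ∈ S ⇔ (z ∈ S₁ ⊎ z ∈ S₂)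

IsInter : ∀ {n} → List (Zone n) → List (Zone n) → List (Zone n) → Set
IsInter Z Z₁ Z₂ = ∀ z → z ∈ Z ⇔ (z ∈ Z₁ × z ∈ Z₂)

OnlyZone : ∀ {n} → Zone n → List (Zone n) → Set
OnlyZone z S = z ∈ S × (∀ z' → z' ∈ S → z' ≡ z)

AdjClosed : ∀ {n} → List (Zone n) → Set
AdjClosed {n} Z = ∀ z → z ∈ missing Z → ∃[ ℓ ] (adj z ℓ ∈ missing Z)

-- The calculus LJ_EV.  Sequents Γ ⇒ Δ of multisets of compound diagrams;
-- multisets are lists taken up to permutation (rule  perm).

infix 3 _⊢_

data _⊢_ : List Diagram → List Diagram → Set where
  perm : ∀ {Γ Γ' Δ Δ'} → Γ ↭ Γ' → Δ ↭ Δ' → Γ ⊢ Δ → Γ' ⊢ Δ'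
  ax   : ∀ {Γ Δ} c → pos c ∷ Γ ⊢ pos c ∷ Δ
  ⊥L   : ∀ {Γ Δ} → ⊥ᵈ ∷ Γ ⊢ Δ
  ⊤R   : ∀ {Γ Δ} → Γ ⊢ ⊤ᵈ ∷ Δ
  ∧L   : ∀ {Γ Δ D E} → D ∷ E ∷ Γ ⊢ Δ → (D ∧ᵈ E) ∷ Γ ⊢ Δ
  ∨L   : ∀ {Γ Δ D E} → D ∷ Γ ⊢ Δ → E ∷ Γ ⊢ Δ → (D ∨ᵈ E) ∷ Γ ⊢ Δ
  ⇒L   : ∀ {Γ Δ D E} → (D ⇒ᵈ E) ∷ Γ ⊢ D ∷ [] → E ∷ Γ ⊢ Δ → (D ⇒ᵈ E) ∷ Γ ⊢ Δ
  ∧R   : ∀ {Γ Δ D E} → Γ ⊢ D ∷ Δ → Γ ⊢ E ∷ Δ → Γ ⊢ (D ∧ᵈ E) ∷ Δ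
  ∨R   : ∀ {Γ Δ D E} → Γ ⊢ D ∷ E ∷ Δ → Γ ⊢ (D ∨ᵈ E) ∷ Δ
  ⇒R   : ∀ {Γ Δ D E} → D ∷ Γ ⊢ E ∷ [] → Γ ⊢ (D ⇒ᵈ E) ∷ Δ
  LitL : ∀ {Γ Δ} c → neg c ∷ Γ ⊢ pos c ∷ [] → neg c ∷ Γ ⊢ Δ
  LitR : ∀ {Γ Δ} c → pos c ∷ Γ ⊢ [] → Γ ⊢ neg c ∷ Δ
  SepL : ∀ {Γ Δ n L} .{u : Unique L} {S S₁ S₂ : List (Zone n)} →
         MoreThanOne S → IsUnion S S₁ S₂ →
         unit (venn n L u S₁) ∷ Γ ⊢ Δ → unit (venn n L u S₂) ∷ Γ ⊢ Δ →
         unit (venn n L u S) ∷ Γ ⊢ Δ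
  SepR : ∀ {Γ Δ n L} .{u : Unique L} {S S₁ S₂ : List (Zone n)} →
         MoreThanOne S → IsUnion S S₁ S₂ →
         Γ ⊢ unit (venn n L u S₁) ∷ unit (venn n L u S₂) ∷ Δ →
         Γ ⊢ unit (venn n L u S) ∷ Δ
  DecL : ∀ {Γ Δ n L} .{u : Unique L} {S : List (Zone n)} (z : Zone n) →
         OnlyZone z S →
         map pos (inside L z) ++ map neg (outside L z) ++ Γ ⊢ Δ →
         unit (venn n L u S) ∷ Γ ⊢ Δ
  DecR : ∀ {Γ Δ n L} .{u : Unique L} {S : List (Zone n)} (z : Zone n) →
         OnlyZone z S →
         (∀ {c} → c ∈ inside L z → Γ ⊢ pos c ∷ Δ) →
         (∀ {c} → c ∈ outside L z → Γ ⊢ neg c ∷ Δ) →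
         Γ ⊢ unit (venn n L u S) ∷ Δ
  RedL : ∀ {Γ Δ n L} .{u : Unique L} {Z : List (Zone n)} →
         AdjClosed Z →
         reductions L u Z ++ Γ ⊢ Δ →
         unit (euler n L u Z) ∷ Γ ⊢ Δ
  RedR : ∀ {Γ Δ n L} .{u : Unique L} {Z : List (Zone n)} →
         AdjClosed Z →
         (∀ {D} → D ∈ reductions L u Z → Γ ⊢ D ∷ Δ) →
         Γ ⊢ unit (euler n L u Z) ∷ Δ
  MSepL : ∀ {Γ Δ n L} .{u : Unique L} {Z Z₁ Z₂ : List (Zone n)} →
          MoreThanOne (missing Z) → IsInter Z Z₁ Z₂ →
          unit (euler n L u Z₁) ∷ unit (euler n L u Z₂) ∷ Γ ⊢ Δ →
          unit (euler n L u Z) ∷ Γ ⊢ Δ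
  MSepR : ∀ {Γ Δ n L} .{u : Unique L} {Z Z₁ Z₂ : List (Zone n)} →
          MoreThanOne (missing Z) → IsInter Z Z₁ Z₂ →
          Γ ⊢ unit (euler n L u Z₁) ∷ Δ → Γ ⊢ unit (euler n L u Z₂) ∷ Δ →
          Γ ⊢ unit (euler n L u Z) ∷ Δ
  ImpDecL : ∀ {Γ Δ n L} .{u : Unique L} {Z : List (Zone n)} (z : Zone n) →
            missing Z ≡ z ∷ [] →
            (∀ {c} → c ∈ inside L z → unit (euler n L u Z) ∷ Γ ⊢ pos c ∷ []) →
            (∀ {c} → c ∈ outside L z → pos c ∷ Γ ⊢ Δ) →
            unit (euler n L u Z) ∷ Γ ⊢ Δ
  ImpDecR : ∀ {Γ Δ n L} .{u : Unique L} {Z : List (Zone n)} (z : Zone n) →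
            missing Z ≡ z ∷ [] →
            Γ ++ map pos (inside L z) ⊢ map pos (outside L z) →
            Γ ⊢ unit (euler n L u Z) ∷ Δ
  -- Euler-Venn rules  (euler(d) = euler n L u Z, venn(d) = venn n L u S)
  DetL : ∀ {Γ Δ n L} .{u : Unique L} {Z S : List (Zone n)} .{s : S ⊆ Z} →
         unit (ev n L u Z S s) ∷ Γ ⊢ unit (euler n L u Z) ∷ [] →
         unit (venn n L u S) ∷ Γ ⊢ Δ →
         unit (ev n L u Z S s) ∷ Γ ⊢ Δ
  DetR : ∀ {Γ Δ n L} .{u : Unique L} {Z S : List (Zone n)} .{s : S ⊆ Z} →
         unit (euler n L u Z) ∷ Γ ⊢ unit (venn n L u S) ∷ [] →
         Γ ⊢ unit (ev n L u Z S s) ∷ Δ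

module Semantics {c ℓ₁ ℓ₂} (H : HeytingAlgebra c ℓ₁ ℓ₂) where
  open HeytingAlgebra H

  ∼_ : Carrier → Carrier
  ∼ a = a ⇨ ⊥

  ⋀ ⋁ : List Carrier → Carrier
  ⋀ = List.foldr _∧_ ⊤
  ⋁ = List.foldr _∨_ ⊥

  module _ (v : Var → Carrier) where
    zoneVal : ∀ {n} → Vec Var n → Zone n → Carrier
    zoneVal L z = ⋀ (map v (inside L z)) ∧ ⋀ (map (λ x → ∼ v x) (outside L z))

    missVal : ∀ {n} → Vec Var n → Zone n → Carrier
    missVal L z = ⋀ (map v (inside L z)) ⇨ ⋁ (map v (outside L z))

    vennVal : ∀ {n} → Vec Var n → List (Zone n) → Carrier
    vennVal L S = ⋁ (map (zoneVal L) S)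

    eulerVal : ∀ {n} → Vec Var n → List (Zone n) → Carrier
    eulerVal L Z = ⋀ (map (missVal L) (missing Z))

    unitVal : Unitary → Carrier
    unitVal (venn n L u S)     = vennVal L S
    unitVal (euler n L u Z)    = eulerVal L Z
    unitVal (ev n L u Z S s)   = eulerVal L Z ⇨ vennVal L S

    ⟦_⟧ : Diagram → Carrier
    ⟦ unit d ⟧   = unitVal d
    ⟦ D ∧ᵈ E ⟧  = ⟦ D ⟧ ∧ ⟦ E ⟧
    ⟦ D ∨ᵈ E ⟧  = ⟦ D ⟧ ∨ ⟦ E ⟧
    ⟦ D ⇒ᵈ E ⟧  = ⟦ D ⟧ ⇨ ⟦ E ⟧

Valid : List Diagram → List Diagram → Setω
Valid Γ Δ = ∀ {c ℓ₁ ℓ₂} (H : HeytingAlgebra c ℓ₁ ℓ₂) (v : Var → HeytingAlgebra.Carrier H) →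
  let open HeytingAlgebra H using (_≤_)
      open Semantics H
  in ⋀ (map (⟦_⟧ v) Γ) ≤ ⋁ (map (⟦_⟧ v) Δ)

-- Once the values of the diagrams involved are compared,
-- most rules are instances of a few sequent shapes (weaken a left formula,
-- strengthen a right one, case split, modus ponens, deduction).  The Euler
-- reduction rules carry the real content.  Removing contour c is resolution
-- on c, (c ∧ I ⇨ O) ∧ (I ⇨ c ∨ O) ≤ (I ⇨ O), applied to the two zones of d
-- that project onto a missing zone of d ∖ c.  Conversely, if z and adj z c
-- are both missing from d then z ∖ c is missing from d ∖ c, and its clause
-- implies the clause of z.
module Submission where

open import Defs
open import Data.List using (List)

open import Data.Nat using (zero; suc)
open import Data.Bool using (true; false)
open import Data.Fin using (Fin; zero; suc)
open import Data.Vec using (Vec; []; _∷_; removeAt; insertAt; lookup)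
open import Data.Vec.Properties using (∷-injective; removeAt-insertAt; insertAt-removeAt)
open import Data.List using ([]; _∷_; _++_; map)
open import Data.List.Properties using (++-assoc; ≡-dec)
open import Data.List.Membership.Propositional using (_∈_; _∉_)
open import Data.List.Membership.Propositional.Properties
  using (∈-map⁺; ∈-map⁻; ∈-concatMap⁺; ∈-filter⁺; ∈-filter⁻; ∈-allFin)
open import Data.List.Relation.Unary.Any as Any using (here; there)
open import Data.List.Relation.Unary.All as All using (All; []; _∷_)
open import Data.List.Relation.Unary.All.Properties
  using () renaming (map⁺ to All-map⁺; ++⁺ to All-++⁺)
open import Data.List.Relation.Binary.Subset.Propositional using (_⊆_)
open import Data.List.Relation.Binary.Permutation.Propositional
  using (_↭_; ↭-refl; ↭-sym; ↭-trans; ↭-prep; ↭-swap)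
open import Data.List.Relation.Binary.Permutation.Propositional.Properties
  using (∈-resp-↭; ++-comm)
open import Data.Vec.Relation.Unary.Unique.Propositional using (Unique)
open import Data.Product using (∃; _×_; _,_; proj₁; proj₂)
open import Data.Sum using (_⊎_; inj₁; inj₂; [_,_]′)
open import Function using (_∘_)
open import Function.Bundles using (Equivalence)
open import Relation.Nullary using (¬_; ¬?; Dec; yes; no)
open import Relation.Binary.PropositionalEquality using (_≡_; _≢_; refl; sym; cong; subst)
open import Relation.Binary.Lattice.Bundles using (HeytingAlgebra)

∈-allZones : ∀ {n} (z : Zone n) → z ∈ allZones n
∈-allZones []      = here refl
∈-allZones (b ∷ z) = ∈-concatMap⁺ _ (Any.map (λ { refl → bothBits b }) (∈-allZones z))
  where
  bothBits : ∀ b → b ∷ z ∈ (true ∷ z) ∷ (false ∷ z) ∷ []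
  bothBits true  = here refl
  bothBits false = there (here refl)

∈-missing⁺ : ∀ {n} {Z : List (Zone n)} {z} → z ∉ Z → z ∈ missing Z
∈-missing⁺ {Z = Z} {z} = ∈-filter⁺ (λ z → ¬? (z ∈z? Z)) (∈-allZones z)

∈-missing⁻ : ∀ {n} {Z : List (Zone n)} {z} → z ∈ missing Z → z ∉ Z
∈-missing⁻ {n} {Z} = proj₂ ∘ ∈-filter⁻ (λ z → ¬? (z ∈z? Z)) {xs = allZones n}

missing-antitone : ∀ {n} {Z Z′ : List (Zone n)} → Z ⊆ Z′ → missing Z′ ⊆ missing Z
missing-antitone Z⊆Z′ z∈ = ∈-missing⁺ (∈-missing⁻ z∈ ∘ Z⊆Z′)

removeAt≡⇒≡⊎adj : ∀ {n} (w z : Zone (suc n)) (i : Fin (suc n)) →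
                  removeAt w i ≡ removeAt z i → w ≡ z ⊎ w ≡ adj z i
removeAt≡⇒≡⊎adj (true  ∷ _) (true  ∷ _) zero refl = inj₁ refl
removeAt≡⇒≡⊎adj (true  ∷ _) (false ∷ _) zero refl = inj₂ refl
removeAt≡⇒≡⊎adj (false ∷ _) (true  ∷ _) zero refl = inj₂ refl
removeAt≡⇒≡⊎adj (false ∷ _) (false ∷ _) zero refl = inj₁ refl
removeAt≡⇒≡⊎adj (a ∷ w@(_ ∷ _)) (b ∷ z@(_ ∷ _)) (suc i) eq with ∷-injective eq
... | refl , eq′ with removeAt≡⇒≡⊎adj w z i eq′
...   | inj₁ w≡z    = inj₁ (cong (a ∷_) w≡z)
...   | inj₂ w≡adjz = inj₂ (cong (a ∷_) w≡adjz)

inside-insertAt-true : ∀ {n} (L : Vec Var (suc n)) z i →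
  inside L (insertAt z i true) ↭ lookup L i ∷ inside (removeAt L i) z
inside-insertAt-true (c ∷ L) z zero = ↭-refl
inside-insertAt-true (c ∷ L@(_ ∷ _)) (true ∷ z) (suc i) =
  ↭-trans (↭-prep c (inside-insertAt-true L z i)) (↭-swap _ _ ↭-refl)
inside-insertAt-true (c ∷ L@(_ ∷ _)) (false ∷ z) (suc i) = inside-insertAt-true L z i

outside-insertAt-true : ∀ {n} (L : Vec Var (suc n)) z i →
  outside L (insertAt z i true) ≡ outside (removeAt L i) z
outside-insertAt-true (c ∷ L) z zero = refl
outside-insertAt-true (c ∷ L@(_ ∷ _)) (true ∷ z) (suc i) = outside-insertAt-true L z i
outside-insertAt-true (c ∷ L@(_ ∷ _)) (false ∷ z) (suc i) =
  cong (c ∷_) (outside-insertAt-true L z i)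

inside-insertAt-false : ∀ {n} (L : Vec Var (suc n)) z i →
  inside L (insertAt z i false) ≡ inside (removeAt L i) z
inside-insertAt-false (c ∷ L) z zero = refl
inside-insertAt-false (c ∷ L@(_ ∷ _)) (true ∷ z) (suc i) =
  cong (c ∷_) (inside-insertAt-false L z i)
inside-insertAt-false (c ∷ L@(_ ∷ _)) (false ∷ z) (suc i) = inside-insertAt-false L z i

outside-insertAt-false : ∀ {n} (L : Vec Var (suc n)) z i →
  outside L (insertAt z i false) ↭ lookup L i ∷ outside (removeAt L i) z
outside-insertAt-false (c ∷ L) z zero = ↭-refl
outside-insertAt-false (c ∷ L@(_ ∷ _)) (true ∷ z) (suc i) = outside-insertAt-false L z i
outside-insertAt-false (c ∷ L@(_ ∷ _)) (false ∷ z) (suc i) =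
  ↭-trans (↭-prep c (outside-insertAt-false L z i)) (↭-swap _ _ ↭-refl)

insertAt-missing : ∀ {n} {Z : List (Zone (suc n))} {z} i b →
                   z ∈ missing (removeZones Z i) → insertAt z i b ∈ missing Z
insertAt-missing {z = z} i b z∈ = ∈-missing⁺ λ z+b∈Z → ∈-missing⁻ z∈
  (subst (_∈ _) (removeAt-insertAt z i b) (∈-map⁺ (λ w → removeAt w i) z+b∈Z))

-- z ∖ c can only come from z or from adj z c, both of which are missing.
removeAt-missing : ∀ {n} {Z : List (Zone (suc n))} {z} i →
                   z ∈ missing Z → adj z i ∈ missing Z →
                   removeAt z i ∈ missing (removeZones Z i)
removeAt-missing {Z = Z} {z} i z∈ adjz∈ =
  ∈-missing⁺ λ z∖c∈ → excluded (∈-map⁻ (λ w → removeAt w i) z∖c∈)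
  where
  excluded : ¬ ∃ λ w → w ∈ Z × removeAt z i ≡ removeAt w i
  excluded (w , w∈Z , eq) with removeAt≡⇒≡⊎adj w z i (sym eq)
  ... | inj₁ refl = ∈-missing⁻ z∈ w∈Z
  ... | inj₂ refl = ∈-missing⁻ adjz∈ w∈Z

∈-reductions⁺ : ∀ {n} (L : Vec Var (suc n)) .(u : Unique L) {Z : List (Zone (suc n))} {z} i →
                z ∈ missing (removeZones Z i) → eulerRemove L u Z i ∈ reductions L u Z
∈-reductions⁺ L u {Z} i z∈ = ∈-map⁺ (eulerRemove L u Z)
  (∈-filter⁺ (λ i → ¬? (≡-dec _≟z_ (missing (removeZones Z i)) [])) (∈-allFin i) nonEmpty)
  where
  nonEmpty : missing (removeZones Z i) ≢ []
  nonEmpty eq with () ← subst (_ ∈_) eq z∈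

∈-reductions⁻ : ∀ {n} (L : Vec Var (suc n)) .(u : Unique L) {Z : List (Zone (suc n))} {D} →
                D ∈ reductions L u Z → ∃ λ i → D ≡ eulerRemove L u Z i
∈-reductions⁻ L u {Z} D∈ with ∈-map⁻ (eulerRemove L u Z) D∈
... | i , _ , D≡ = i , D≡

module HeytingLemmas {c ℓ₁ ℓ₂} (H : HeytingAlgebra c ℓ₁ ℓ₂) where
  open HeytingAlgebra H renaming (refl to ≤-refl)
  open Semantics H using (⋀; ⋁)
  open import Relation.Binary.Lattice.Properties.HeytingAlgebra H
    using (⇨-eval; ∧-distribˡ-∨-≤; distributiveLattice)
  open import Relation.Binary.Lattice.Properties.DistributiveLattice distributiveLattice
    using (∧-distribʳ-∨; ∨-distribʳ-∧)
  open import Relation.Binary.Lattice.Properties.MeetSemilattice meetSemilattice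
    using (∧-monotonic; ∧-cong; ∧-assoc)
  open import Relation.Binary.Lattice.Properties.JoinSemilattice joinSemilattice
    using (∨-monotonic; ∨-cong; ∨-assoc)
  open import Relation.Binary.Lattice.Properties.BoundedMeetSemilattice boundedMeetSemilattice
    using () renaming (identityˡ to ∧-identityˡ)
  open import Relation.Binary.Lattice.Properties.BoundedJoinSemilattice boundedJoinSemilattice
    using () renaming (identityˡ to ∨-identityˡ)
  open import Relation.Binary.Reasoning.PartialOrder poset

  x∨⊥≤x : ∀ {x} → x ∨ ⊥ ≤ x
  x∨⊥≤x = ∨-least ≤-refl (minimum _)

  x≤x∧⊤ : ∀ {x} → x ≤ x ∧ ⊤
  x≤x∧⊤ = ∧-greatest ≤-refl (maximum _)

  ⇨-resolve : ∀ {a i o} → (a ∧ i ⇨ o) ∧ (i ⇨ a ∨ o) ≤ i ⇨ o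
  ⇨-resolve {a} {i} {o} = transpose-⇨ (begin
    ((a ∧ i ⇨ o) ∧ (i ⇨ a ∨ o)) ∧ i
      ≤⟨ ∧-greatest (∧-monotonic (x∧y≤x _ _) ≤-refl)
                    (trans (∧-monotonic (x∧y≤y _ _) ≤-refl) ⇨-eval) ⟩
    ((a ∧ i ⇨ o) ∧ i) ∧ (a ∨ o)
      ≤⟨ ∧-distribˡ-∨-≤ _ _ _ ⟩
    ((a ∧ i ⇨ o) ∧ i) ∧ a ∨ ((a ∧ i ⇨ o) ∧ i) ∧ o
      ≤⟨ ∨-monotonic (∧-greatest (trans (x∧y≤x _ _) (x∧y≤x _ _)) reassoc) (x∧y≤y _ _) ⟩
    (a ∧ i ⇨ o) ∧ (a ∧ i) ∨ o
      ≤⟨ ∨-least ⇨-eval ≤-refl ⟩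
    o ∎)
    where
    reassoc : ((a ∧ i ⇨ o) ∧ i) ∧ a ≤ a ∧ i
    reassoc = ∧-greatest (x∧y≤y _ _) (trans (x∧y≤x _ _) (x∧y≤y _ _))

  module _ {a} {A : Set a} (f : A → Carrier) where

    ⋀-lowerBound : ∀ {x xs} → x ∈ xs → ⋀ (map f xs) ≤ f x
    ⋀-lowerBound (here refl) = x∧y≤x _ _
    ⋀-lowerBound (there x∈)  = trans (x∧y≤y _ _) (⋀-lowerBound x∈)

    ⋀-greatest : ∀ {y} xs → (∀ {x} → x ∈ xs → y ≤ f x) → y ≤ ⋀ (map f xs)
    ⋀-greatest []       _ = maximum _
    ⋀-greatest (x ∷ xs) h = ∧-greatest (h (here refl)) (⋀-greatest xs (h ∘ there))

    ⋁-upperBound : ∀ {x xs} → x ∈ xs → f x ≤ ⋁ (map f xs)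
    ⋁-upperBound (here refl) = x≤x∨y _ _
    ⋁-upperBound (there x∈)  = trans (⋁-upperBound x∈) (y≤x∨y _ _)

    ⋁-least : ∀ {y} xs → (∀ {x} → x ∈ xs → f x ≤ y) → ⋁ (map f xs) ≤ y
    ⋁-least []       _ = minimum _
    ⋁-least (x ∷ xs) h = ∨-least (h (here refl)) (⋁-least xs (h ∘ there))

    ⋀-antitone : ∀ {xs ys} → xs ⊆ ys → ⋀ (map f ys) ≤ ⋀ (map f xs)
    ⋀-antitone {xs} xs⊆ys = ⋀-greatest xs (⋀-lowerBound ∘ xs⊆ys)

    ⋁-monotone : ∀ {xs ys} → xs ⊆ ys → ⋁ (map f xs) ≤ ⋁ (map f ys)
    ⋁-monotone {xs} xs⊆ys = ⋁-least xs (⋁-upperBound ∘ xs⊆ys)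

    ⋀-++ : ∀ xs ys → ⋀ (map f (xs ++ ys)) ≈ ⋀ (map f xs) ∧ ⋀ (map f ys)
    ⋀-++ []       ys = Eq.sym (∧-identityˡ _)
    ⋀-++ (x ∷ xs) ys = Eq.trans (∧-cong Eq.refl (⋀-++ xs ys)) (Eq.sym (∧-assoc _ _ _))

    ⋁-++ : ∀ xs ys → ⋁ (map f (xs ++ ys)) ≈ ⋁ (map f xs) ∨ ⋁ (map f ys)
    ⋁-++ []       ys = Eq.sym (∨-identityˡ _)
    ⋁-++ (x ∷ xs) ys = Eq.trans (∨-cong Eq.refl (⋁-++ xs ys)) (Eq.sym (∨-assoc _ _ _))

    ⋀-greatest-∨ : ∀ {y d} xs → (∀ {x} → x ∈ xs → y ≤ f x ∨ d) → y ≤ ⋀ (map f xs) ∨ d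
    ⋀-greatest-∨ []       _ = trans (maximum _) (x≤x∨y _ _)
    ⋀-greatest-∨ (x ∷ xs) h =
      trans (∧-greatest (h (here refl)) (⋀-greatest-∨ xs (h ∘ there)))
            (reflexive (Eq.sym (∨-distribʳ-∧ _ _ _)))

    ⋁-least-∧ : ∀ {g d} xs → (∀ {x} → x ∈ xs → f x ∧ g ≤ d) → ⋁ (map f xs) ∧ g ≤ d
    ⋁-least-∧ []       _ = trans (x∧y≤x _ _) (minimum _)
    ⋁-least-∧ (x ∷ xs) h =
      trans (reflexive (∧-distribʳ-∨ _ _ _))
            (∨-least (h (here refl)) (⋁-least-∧ xs (h ∘ there)))

    ⋀-map-∘ : ∀ {b} {B : Set b} (g : B → A) {h : B → Carrier} →
              (∀ x → f (g x) ≈ h x) → ∀ xs → ⋀ (map f (map g xs)) ≈ ⋀ (map h xs)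
    ⋀-map-∘ g f∘g≈h []       = Eq.refl
    ⋀-map-∘ g f∘g≈h (x ∷ xs) = ∧-cong (f∘g≈h x) (⋀-map-∘ g f∘g≈h xs)

    ⋁-map-∘ : ∀ {b} {B : Set b} (g : B → A) {h : B → Carrier} →
              (∀ x → f (g x) ≈ h x) → ∀ xs → ⋁ (map f (map g xs)) ≈ ⋁ (map h xs)
    ⋁-map-∘ g f∘g≈h []       = Eq.refl
    ⋁-map-∘ g f∘g≈h (x ∷ xs) = ∨-cong (f∘g≈h x) (⋁-map-∘ g f∘g≈h xs)

literals : ∀ {n} → Vec Var n → Zone n → List Diagram
literals L z = map pos (inside L z) ++ map neg (outside L z)

module Soundness {c ℓ₁ ℓ₂} (H : HeytingAlgebra c ℓ₁ ℓ₂)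
                 (v : Var → HeytingAlgebra.Carrier H) where
  open HeytingAlgebra H renaming (refl to ≤-refl)
  open Semantics H
  open HeytingLemmas H
  open import Relation.Binary.Lattice.Properties.HeytingAlgebra H
    using (⇨-eval; ⇨-relax; ⇨-cong; swap-transpose-⇨; distributiveLattice)
  open import Relation.Binary.Lattice.Properties.DistributiveLattice distributiveLattice
    using (∧-distribʳ-∨)
  open import Relation.Binary.Lattice.Properties.MeetSemilattice meetSemilattice
    using (∧-monotonic; ∧-cong)
  open import Relation.Binary.Lattice.Properties.JoinSemilattice joinSemilattice
    using (∨-monotonic)
  open import Relation.Binary.Lattice.Properties.BoundedMeetSemilattice boundedMeetSemilattice
    using () renaming (identityʳ to ∧-identityʳ)
  open import Relation.Binary.Reasoning.PartialOrder poset

  ⟪_⟫ : Diagram → Carrier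
  ⟪_⟫ = ⟦_⟧ v

  -- A record rather than a definition, so that Γ and Δ stay inferable.
  infix 3 _⊨_
  record _⊨_ (Γ Δ : List Diagram) : Set ℓ₂ where
    constructor entails
    field ⋀≤⋁ : ⋀ (map ⟪_⟫ Γ) ≤ ⋁ (map ⟪_⟫ Δ)
  open _⊨_

  ⟪pos⟫ : ∀ x → ⟪ pos x ⟫ ≈ v x
  ⟪pos⟫ x = antisym (∨-least (trans (x∧y≤x _ _) (x∧y≤x _ _)) (minimum _))
                    (trans (∧-greatest x≤x∧⊤ (maximum _)) (x≤x∨y _ _))

  ⟪neg⟫ : ∀ x → ⟪ neg x ⟫ ≈ ∼ v x
  ⟪neg⟫ x = antisym (∨-least (trans (x∧y≤y _ _) (x∧y≤x _ _)) (minimum _))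
                    (trans (∧-greatest (maximum _) x≤x∧⊤) (x≤x∨y _ _))

  ⟪neg⟫≈⟪pos⟫⇨⊥ : ∀ x → ⟪ neg x ⟫ ≈ ⟪ pos x ⟫ ⇨ ⟪ ⊥ᵈ ⟫
  ⟪neg⟫≈⟪pos⟫⇨⊥ x = Eq.trans (⟪neg⟫ x) (⇨-cong (Eq.sym (⟪pos⟫ x)) Eq.refl)

  vennVal-only : ∀ {n} (L : Vec Var n) {S z} → OnlyZone z S → vennVal v L S ≈ zoneVal v L z
  vennVal-only L {S} {z} (z∈S , onlyZ) =
    antisym (⋁-least (zoneVal v L) S below) (⋁-upperBound (zoneVal v L) z∈S)
    where
    below : ∀ {z′} → z′ ∈ S → zoneVal v L z′ ≤ zoneVal v L z
    below z′∈S with refl ← onlyZ _ z′∈S = ≤-refl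

  vennVal≈⋀literals : ∀ {n} (L : Vec Var n) {S z} → OnlyZone z S →
                      vennVal v L S ≈ ⋀ (map ⟪_⟫ (literals L z))
  vennVal≈⋀literals L {z = z} only = Eq.trans (vennVal-only L only) (Eq.sym (Eq.trans
    (⋀-++ ⟪_⟫ (map pos (inside L z)) (map neg (outside L z)))
    (∧-cong (⋀-map-∘ ⟪_⟫ pos ⟪pos⟫ (inside L z)) (⋀-map-∘ ⟪_⟫ neg ⟪neg⟫ (outside L z)))))

  vennVal-∪ : ∀ {n} (L : Vec Var n) {S S₁ S₂} → IsUnion S S₁ S₂ →
              vennVal v L S ≈ vennVal v L S₁ ∨ vennVal v L S₂
  vennVal-∪ L {S} S≡ = antisym
    (⋁-least (zoneVal v L) S λ z∈S →
      [ (λ z∈S₁ → trans (⋁-upperBound _ z∈S₁) (x≤x∨y _ _))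
      , (λ z∈S₂ → trans (⋁-upperBound _ z∈S₂) (y≤x∨y _ _))
      ]′ (Equivalence.to (S≡ _) z∈S))
    (∨-least (⋁-monotone (zoneVal v L) (Equivalence.from (S≡ _) ∘ inj₁))
             (⋁-monotone (zoneVal v L) (Equivalence.from (S≡ _) ∘ inj₂)))

  eulerVal-mono : ∀ {n} (L : Vec Var n) {Z Z′} → Z ⊆ Z′ → eulerVal v L Z ≤ eulerVal v L Z′
  eulerVal-mono L Z⊆Z′ = ⋀-antitone (missVal v L) (missing-antitone Z⊆Z′)

  eulerVal-∩ : ∀ {n} (L : Vec Var n) {Z Z₁ Z₂} → IsInter Z Z₁ Z₂ →
               eulerVal v L Z ≈ eulerVal v L Z₁ ∧ eulerVal v L Z₂
  eulerVal-∩ L {Z} {Z₁} {Z₂} Z≡ = antisym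
    (∧-greatest (eulerVal-mono L (proj₁ ∘ Equivalence.to (Z≡ _)))
                (eulerVal-mono L (proj₂ ∘ Equivalence.to (Z≡ _))))
    (⋀-greatest (missVal v L) (missing Z) λ z∈ → missingFromOne z∈ (_ ∈z? Z₁))
    where
    missingFromOne : ∀ {z} → z ∈ missing Z → Dec (z ∈ Z₁) →
                     eulerVal v L Z₁ ∧ eulerVal v L Z₂ ≤ missVal v L z
    missingFromOne z∈ (no z∉Z₁)  = trans (x∧y≤x _ _) (⋀-lowerBound _ (∈-missing⁺ z∉Z₁))
    missingFromOne z∈ (yes z∈Z₁) = trans (x∧y≤y _ _) (⋀-lowerBound _ (∈-missing⁺ λ z∈Z₂ →
      ∈-missing⁻ z∈ (Equivalence.from (Z≡ _) (z∈Z₁ , z∈Z₂))))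

  eulerVal≈⇨literals : ∀ {n} (L : Vec Var n) {Z z} → missing Z ≡ z ∷ [] →
    eulerVal v L Z ≈ ⋀ (map ⟪_⟫ (map pos (inside L z))) ⇨ ⋁ (map ⟪_⟫ (map pos (outside L z)))
  eulerVal≈⇨literals L {z = z} miss≡ = Eq.trans
    (subst (λ M → ⋀ (map (missVal v L) M) ≈ missVal v L z) (sym miss≡) (∧-identityʳ _))
    (Eq.sym (⇨-cong (⋀-map-∘ ⟪_⟫ pos ⟪pos⟫ (inside L z)) (⋁-map-∘ ⟪_⟫ pos ⟪pos⟫ (outside L z))))

  missVal-resolve : ∀ {n} (L : Vec Var (suc n)) z i →
    missVal v L (insertAt z i true) ∧ missVal v L (insertAt z i false) ≤ missVal v (removeAt L i) z
  missVal-resolve L z i =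
    trans (∧-monotonic (⇨-relax inTrue outTrue) (⇨-relax inFalse outFalse)) ⇨-resolve
    where
    I O : List Carrier
    I = map v (inside (removeAt L i) z)
    O = map v (outside (removeAt L i) z)
    inTrue : v (lookup L i) ∧ ⋀ I ≤ ⋀ (map v (inside L (insertAt z i true)))
    inTrue = ⋀-antitone v (∈-resp-↭ (inside-insertAt-true L z i))
    outTrue : ⋁ (map v (outside L (insertAt z i true))) ≤ ⋁ O
    outTrue = ⋁-monotone v (subst (_ ∈_) (outside-insertAt-true L z i))
    inFalse : ⋀ I ≤ ⋀ (map v (inside L (insertAt z i false)))
    inFalse = ⋀-antitone v (subst (_ ∈_) (inside-insertAt-false L z i))
    outFalse : ⋁ (map v (outside L (insertAt z i false))) ≤ v (lookup L i) ∨ ⋁ O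
    outFalse = ⋁-monotone v (∈-resp-↭ (outside-insertAt-false L z i))

  missVal-weaken : ∀ {n} (L : Vec Var (suc n)) z i b →
    missVal v (removeAt L i) z ≤ missVal v L (insertAt z i b)
  missVal-weaken L z i true = ⇨-relax
    (⋀-antitone v (∈-resp-↭ (↭-sym (inside-insertAt-true L z i)) ∘ there))
    (⋁-monotone v (subst (_ ∈_) (sym (outside-insertAt-true L z i))))
  missVal-weaken L z i false = ⇨-relax
    (⋀-antitone v (subst (_ ∈_) (sym (inside-insertAt-false L z i))))
    (⋁-monotone v (∈-resp-↭ (↭-sym (outside-insertAt-false L z i)) ∘ there))

  eulerVal-removeAt : ∀ {n} (L : Vec Var (suc n)) Z i →
    eulerVal v L Z ≤ eulerVal v (removeAt L i) (removeZones Z i)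
  eulerVal-removeAt L Z i =
    ⋀-greatest (missVal v (removeAt L i)) (missing (removeZones Z i)) λ z∈ →
      trans (∧-greatest (⋀-lowerBound (missVal v L) (insertAt-missing i true z∈))
                        (⋀-lowerBound (missVal v L) (insertAt-missing i false z∈)))
            (missVal-resolve L _ i)

  eulerVal≤⋀reductions : ∀ {n} (L : Vec Var n) .(u : Unique L) Z →
    eulerVal v L Z ≤ ⋀ (map ⟪_⟫ (reductions L u Z))
  eulerVal≤⋀reductions {zero}  L u Z = maximum _
  eulerVal≤⋀reductions {suc n} L u Z =
    ⋀-greatest ⟪_⟫ (reductions L u Z) λ D∈ → boundByRemoval (∈-reductions⁻ L u D∈)
    where
    boundByRemoval : ∀ {D} → ∃ (λ i → D ≡ eulerRemove L u Z i) → eulerVal v L Z ≤ ⟪ D ⟫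
    boundByRemoval (i , refl) = eulerVal-removeAt L Z i

  ⋀reductions≤eulerVal : ∀ {n} (L : Vec Var n) .(u : Unique L) Z → AdjClosed Z →
    ⋀ (map ⟪_⟫ (reductions L u Z)) ≤ eulerVal v L Z
  ⋀reductions≤eulerVal {zero} L u Z adjClosed =
    ⋀-greatest (missVal v L) (missing Z) λ z∈ → noContour (adjClosed _ z∈)
    where
    noContour : ∀ {z} → ∃ (λ (i : Fin 0) → adj z i ∈ missing Z) → ⊤ ≤ missVal v L z
    noContour (() , _)
  ⋀reductions≤eulerVal {suc n} L u Z adjClosed =
    ⋀-greatest (missVal v L) (missing Z) λ z∈ → viaNeighbour z∈ (adjClosed _ z∈)
    where
    viaNeighbour : ∀ {z} → z ∈ missing Z → ∃ (λ i → adj z i ∈ missing Z) →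
                   ⋀ (map ⟪_⟫ (reductions L u Z)) ≤ missVal v L z
    viaNeighbour {z} z∈ (i , adjz∈) = begin
      ⋀ (map ⟪_⟫ (reductions L u Z))
        ≤⟨ ⋀-lowerBound ⟪_⟫ (∈-reductions⁺ L u i z∖c∈) ⟩
      eulerVal v (removeAt L i) (removeZones Z i)
        ≤⟨ ⋀-lowerBound (missVal v (removeAt L i)) z∖c∈ ⟩
      missVal v (removeAt L i) (removeAt z i)
        ≤⟨ missVal-weaken L (removeAt z i) i (lookup z i) ⟩
      missVal v L (insertAt (removeAt z i) i (lookup z i))
        ≡⟨ cong (missVal v L) (insertAt-removeAt z i) ⟩
      missVal v L z ∎
      where
      z∖c∈ : removeAt z i ∈ missing (removeZones Z i)
      z∖c∈ = removeAt-missing i z∈ adjz∈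

  ⊨-perm : ∀ {Γ Γ′ Δ Δ′} → Γ ↭ Γ′ → Δ ↭ Δ′ → Γ ⊨ Δ → Γ′ ⊨ Δ′
  ⊨-perm Γ↭ Δ↭ (entails Γ≤Δ) = entails
    (trans (⋀-antitone ⟪_⟫ (∈-resp-↭ Γ↭)) (trans Γ≤Δ (⋁-monotone ⟪_⟫ (∈-resp-↭ Δ↭))))

  ⊨-weakenʳ : ∀ {Γ Δ D} → Γ ⊨ Δ → Γ ⊨ D ∷ Δ
  ⊨-weakenʳ (entails Γ≤Δ) = entails (trans Γ≤Δ (y≤x∨y _ _))

  ⊨-⊥ᵈ : ∀ {Γ Δ} → ⊥ᵈ ∷ Γ ⊨ Δ
  ⊨-⊥ᵈ = entails (trans (x∧y≤x _ _) (minimum _))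

  ⊨-left : ∀ {Γ Δ D} Ds → ⟪ D ⟫ ≤ ⋀ (map ⟪_⟫ Ds) → Ds ++ Γ ⊨ Δ → D ∷ Γ ⊨ Δ
  ⊨-left {Γ} Ds D≤ (entails Ds,Γ≤Δ) = entails
    (trans (∧-monotonic D≤ ≤-refl) (trans (reflexive (Eq.sym (⋀-++ ⟪_⟫ Ds Γ))) Ds,Γ≤Δ))

  ⊨-right : ∀ {Γ Δ D} Ds → ⋁ (map ⟪_⟫ Ds) ≤ ⟪ D ⟫ → Γ ⊨ Ds ++ Δ → Γ ⊨ D ∷ Δ
  ⊨-right {Δ = Δ} Ds ≤D (entails Γ≤Ds,Δ) = entails
    (trans Γ≤Ds,Δ (trans (reflexive (⋁-++ ⟪_⟫ Ds Δ)) (∨-monotonic ≤D ≤-refl)))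

  ⊨-left-∨ : ∀ {Γ Δ D E₁ E₂} → ⟪ D ⟫ ≤ ⟪ E₁ ⟫ ∨ ⟪ E₂ ⟫ →
             E₁ ∷ Γ ⊨ Δ → E₂ ∷ Γ ⊨ Δ → D ∷ Γ ⊨ Δ
  ⊨-left-∨ D≤ (entails E₁,Γ≤Δ) (entails E₂,Γ≤Δ) = entails
    (trans (∧-monotonic D≤ ≤-refl)
           (trans (reflexive (∧-distribʳ-∨ _ _ _)) (∨-least E₁,Γ≤Δ E₂,Γ≤Δ)))

  ⊨-right-∧ : ∀ {Γ Δ D} Ds → ⋀ (map ⟪_⟫ Ds) ≤ ⟪ D ⟫ →
              All (λ E → Γ ⊨ E ∷ Δ) Ds → Γ ⊨ D ∷ Δ
  ⊨-right-∧ Ds ≤D Γ⊨Ds = entails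
    (trans (⋀-greatest-∨ ⟪_⟫ Ds (⋀≤⋁ ∘ All.lookup Γ⊨Ds)) (∨-monotonic ≤D ≤-refl))

  ⊨-left-⇨ : ∀ {Γ Δ D} As Bs → ⟪ D ⟫ ≤ ⋀ (map ⟪_⟫ As) ⇨ ⋁ (map ⟪_⟫ Bs) →
             All (λ A → D ∷ Γ ⊨ A ∷ []) As → All (λ B → B ∷ Γ ⊨ Δ) Bs → D ∷ Γ ⊨ Δ
  ⊨-left-⇨ {Γ} {D = D} As Bs D≤ ⊨As Bs⊨ = entails
    (trans (∧-greatest ≤⋁Bs (x∧y≤y _ _)) (⋁-least-∧ ⟪_⟫ Bs (⋀≤⋁ ∘ All.lookup Bs⊨)))
    where
    ≤⋀As : ⟪ D ⟫ ∧ ⋀ (map ⟪_⟫ Γ) ≤ ⋀ (map ⟪_⟫ As)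
    ≤⋀As = ⋀-greatest ⟪_⟫ As λ A∈ → trans (⋀≤⋁ (All.lookup ⊨As A∈)) x∨⊥≤x
    ≤⋁Bs : ⟪ D ⟫ ∧ ⋀ (map ⟪_⟫ Γ) ≤ ⋁ (map ⟪_⟫ Bs)
    ≤⋁Bs = trans (∧-greatest (trans (x∧y≤x _ _) D≤) ≤⋀As) ⇨-eval

  ⊨-right-⇨ : ∀ {Γ Δ D} As Bs → ⋀ (map ⟪_⟫ As) ⇨ ⋁ (map ⟪_⟫ Bs) ≤ ⟪ D ⟫ →
              As ++ Γ ⊨ Bs → Γ ⊨ D ∷ Δ
  ⊨-right-⇨ {Γ} As Bs ≤D (entails As,Γ≤Bs) = entails
    (trans (swap-transpose-⇨ (trans (reflexive (Eq.sym (⋀-++ ⟪_⟫ As Γ))) As,Γ≤Bs))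
           (trans ≤D (x≤x∨y _ _)))

  ⊨-mp : ∀ {Γ Δ D A B} → ⟪ D ⟫ ≤ ⟪ A ⟫ ⇨ ⟪ B ⟫ →
         D ∷ Γ ⊨ A ∷ [] → B ∷ Γ ⊨ Δ → D ∷ Γ ⊨ Δ
  ⊨-mp D≤ D,Γ⊨A B,Γ⊨Δ = ⊨-left-⇨ (_ ∷ []) (_ ∷ [])
    (trans D≤ (⇨-relax (x∧y≤x _ _) (x≤x∨y _ _))) (D,Γ⊨A ∷ []) (B,Γ⊨Δ ∷ [])

  ⊨-deduction : ∀ {Γ Δ D A B} → ⟪ A ⟫ ⇨ ⟪ B ⟫ ≤ ⟪ D ⟫ → A ∷ Γ ⊨ B ∷ [] → Γ ⊨ D ∷ Δ
  ⊨-deduction ≤D A,Γ⊨B =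
    ⊨-right-⇨ (_ ∷ []) (_ ∷ []) (trans (⇨-relax x≤x∧⊤ x∨⊥≤x) ≤D) A,Γ⊨B

  sound : ∀ {Γ Δ} → Γ ⊢ Δ → Γ ⊨ Δ
  sound (perm Γ↭ Δ↭ d) = ⊨-perm Γ↭ Δ↭ (sound d)
  sound (ax x)         = entails (trans (x∧y≤x _ _) (x≤x∨y _ _))
  sound ⊥L             = ⊨-⊥ᵈ
  sound ⊤R             = ⊨-right-∧ [] (trans x≤x∧⊤ (x≤x∨y _ _)) []
  sound (∧L d)         = ⊨-left (_ ∷ _ ∷ []) (∧-monotonic ≤-refl x≤x∧⊤) (sound d)
  sound (∨L d e)       = ⊨-left-∨ ≤-refl (sound d) (sound e)
  sound (⇒L d e)       = ⊨-mp ≤-refl (sound d) (sound e)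
  sound (∧R d e)       =
    ⊨-right-∧ (_ ∷ _ ∷ []) (∧-monotonic ≤-refl (x∧y≤x _ _)) (sound d ∷ sound e ∷ [])
  sound (∨R d)         = ⊨-right (_ ∷ _ ∷ []) (∨-monotonic ≤-refl x∨⊥≤x) (sound d)
  sound (⇒R d)         = ⊨-deduction ≤-refl (sound d)
  sound (LitL x d)     = ⊨-mp (reflexive (⟪neg⟫≈⟪pos⟫⇨⊥ x)) (sound d) ⊨-⊥ᵈ
  sound (LitR x d)     =
    ⊨-deduction (reflexive (Eq.sym (⟪neg⟫≈⟪pos⟫⇨⊥ x))) (⊨-weakenʳ {D = ⊥ᵈ} (sound d))
  sound (SepL {L = L} _ S≡ d e) = ⊨-left-∨ (reflexive (vennVal-∪ L S≡)) (sound d) (sound e)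
  sound (SepR {L = L} _ S≡ d)   = ⊨-right (_ ∷ _ ∷ [])
    (trans (∨-monotonic ≤-refl x∨⊥≤x) (reflexive (Eq.sym (vennVal-∪ L S≡)))) (sound d)
  sound (DecL {Γ} {Δ} {L = L} z only d) =
    ⊨-left (literals L z) (reflexive (vennVal≈⋀literals L only))
      (subst (_⊨ Δ) (sym (++-assoc (map pos (inside L z)) (map neg (outside L z)) Γ)) (sound d))
  sound (DecR {L = L} z only ins outs) =
    ⊨-right-∧ (literals L z) (reflexive (Eq.sym (vennVal≈⋀literals L only)))
      (All-++⁺ (All-map⁺ (All.tabulate λ c∈ → sound (ins c∈)))
               (All-map⁺ (All.tabulate λ c∈ → sound (outs c∈))))
  sound (RedL {L = L} {u} {Z} _ d) =
    ⊨-left (reductions L u Z) (eulerVal≤⋀reductions L u Z) (sound d)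
  sound (RedR {L = L} {u} {Z} adjClosed ds) =
    ⊨-right-∧ (reductions L u Z) (⋀reductions≤eulerVal L u Z adjClosed)
      (All.tabulate λ D∈ → sound (ds D∈))
  sound (MSepL {L = L} _ Z≡ d) = ⊨-left (_ ∷ _ ∷ [])
    (trans (reflexive (eulerVal-∩ L Z≡)) (∧-monotonic ≤-refl x≤x∧⊤)) (sound d)
  sound (MSepR {L = L} _ Z≡ d e) = ⊨-right-∧ (_ ∷ _ ∷ [])
    (trans (∧-monotonic ≤-refl (x∧y≤x _ _)) (reflexive (Eq.sym (eulerVal-∩ L Z≡))))
    (sound d ∷ sound e ∷ [])
  sound (ImpDecL {L = L} z miss≡ ins outs) =
    ⊨-left-⇨ (map pos (inside L z)) (map pos (outside L z))
      (reflexive (eulerVal≈⇨literals L miss≡))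
      (All-map⁺ (All.tabulate λ c∈ → sound (ins c∈)))
      (All-map⁺ (All.tabulate λ c∈ → sound (outs c∈)))
  sound (ImpDecR {Γ} {L = L} z miss≡ d) =
    ⊨-right-⇨ (map pos (inside L z)) (map pos (outside L z))
      (reflexive (Eq.sym (eulerVal≈⇨literals L miss≡)))
      (⊨-perm (++-comm Γ _) ↭-refl (sound d))
  sound (DetL d e) = ⊨-mp ≤-refl (sound d) (sound e)
  sound (DetR d)   = ⊨-deduction ≤-refl (sound d)

theorem1 : (Γ Δ : List Diagram) → Γ ⊢ Δ → Valid Γ Δ
theorem1 Γ Δ Γ⊢Δ H v = Soundness._⊨_.⋀≤⋁ (Soundness.sound H v Γ⊢Δ)
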